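{- Let $\mathcal{P}=(Q,T)$ be a replicated system. For every set $U\subseteq T$ of transitions, the (downward) decompositions of both $[\![\mathrm{dis}(U)]\!]$ and $[\![\mathrm{dead}(U)]\!]$ are effectively computable.
   Context: A replicated system of arity $n$ over a finite set $Q$ is a pair $\mathcal{P}=(Q,T)$ with $T\subseteq\bigcup_{k=0}^n Q^{(k)}\times Q^{(k)}$ ($Q^{(k)}$ = multisets over $Q$ of size $k$), containing every silent pair $(x,x)$, $x\in Q^{(k)}$, $k\le n$. Configurations are multisets $C\in\mathbb{N}^Q$. For $t=(x,y)\in T$, $t$ is enabled at $C$ if $C\ge x$ componentwise (otherwise disabled), and then $C\xrightarrow{t}C-x+y$. A transition is dead at $C$ if it is disabled at every configuration reachable from $C$ (including $C$). $[\![\mathrm{dis}(U)]\!]$ is the set of configurations at which all transitions of $U$ are disabled, and $[\![\mathrm{dead}(U)]\!]$ the set of configurations at which all transitions of $U$ are dead; both are downward closed. An $\omega$-configuration is a map $Q\to\mathbb{N}\cup\{\omega\}$ (with $m<\omega$ for all $m\in\mathbb{N}$). For a set $\mathcal{C}^\omega$ of $\omega$-configurations, $\downarrow\mathcal{C}^\omega=\{C\in\mathbb{N}^Q: C\le C^\omega$ for some $C^\omega\in\mathcal{C}^\omega\}$. A set $\mathcal{C}$ of configurations is downward closed if $C\in\mathcal{C}$ and $C'\le C$ imply $C'\in\mathcal{C}$; every such set has a unique minimal finite set of $\omega$-configurations, its decomposition, whose downward closure equals $\mathcal{C}$. -}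

module Defs where

open import Data.Nat using (ℕ; _≤_; _<_; _+_; _∸_)
open import Data.Vec using (Vec; zipWith; sum)
open import Data.Vec.Relation.Binary.Pointwise.Inductive using (Pointwise)
open import Data.List using (List)
open import Data.List.Membership.Propositional using (_∈_)
open import Data.List.Relation.Binary.Subset.Propositional using (_⊆_)
open import Data.List.Relation.Unary.Any using (Any)
open import Data.List.Relation.Unary.All using (All)
open import Data.List.Relation.Unary.AllPairs using (AllPairs)
open import Data.Product using (Σ; _×_; ∃)
open import Relation.Nullary using (¬_)
open import Relation.Binary.PropositionalEquality using (_≡_)
open import Relation.Binary.Construct.Closure.ReflexiveTransitive using (Star)
open import Function.Bundles using (_⇔_)

-- The finite state set Q is Fin q; configurations (multisets over Q) are
-- vectors of multiplicities.
Config : ℕ → Set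
Config q = Vec ℕ q

_≤ᶜ_ : ∀ {q} → Config q → Config q → Set
C ≤ᶜ D = Pointwise _≤_ C D

size : ∀ {q} → Config q → ℕ
size = sum

record Trans (q : ℕ) : Set where
  constructor _⇒_
  field
    pre  : Config q
    post : Config q
open Trans public

record ReplicatedSystem : Set where
  field
    q     : ℕ
    arity : ℕ
    T     : List (Trans q)
    T-wf  : All (λ t → size (pre t) ≡ size (post t) × size (pre t) ≤ arity) T
    T-silent : ∀ (x : Config q) → size x ≤ arity → (x ⇒ x) ∈ T
open ReplicatedSystem public

enabled : ∀ {q} → Trans q → Config q → Set
enabled t C = pre t ≤ᶜ C

disabled : ∀ {q} → Trans q → Config q → Set
disabled t C = ¬ enabled t C

fire : ∀ {q} → Trans q → Config q → Config q
fire t C = zipWith _+_ (zipWith _∸_ C (pre t)) (post t)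

Step : (P : ReplicatedSystem) → Config (q P) → Config (q P) → Set
Step P C C' = Σ (Trans (q P)) λ t → t ∈ T P × enabled t C × C' ≡ fire t C

Reach : (P : ReplicatedSystem) → Config (q P) → Config (q P) → Set
Reach P = Star (Step P)

dead : (P : ReplicatedSystem) → Trans (q P) → Config (q P) → Set
dead P t C = ∀ C' → Reach P C C' → disabled t C'

Dis : (P : ReplicatedSystem) → List (Trans (q P)) → Config (q P) → Set
Dis P U C = All (λ t → disabled t C) U

Dead : (P : ReplicatedSystem) → List (Trans (q P)) → Config (q P) → Set
Dead P U C = All (λ t → dead P t C) U

data ℕω : Set where
  fin : ℕ → ℕω
  ω   : ℕω

data _≤ω_ : ℕω → ℕω → Set where
  fin≤fin : ∀ {m n} → m ≤ n → fin m ≤ω fin n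
  _≤ω-top : ∀ a → a ≤ω ω

OmegaConfig : ℕ → Set
OmegaConfig q = Vec ℕω q

_≤Ω_ : ∀ {q} → OmegaConfig q → OmegaConfig q → Set
A ≤Ω B = Pointwise _≤ω_ A B

_⊑_ : ∀ {q} → Config q → OmegaConfig q → Set
C ⊑ A = Pointwise (λ m a → fin m ≤ω a) C A

-- D (a finite set of ω-configurations, as a list) is THE decomposition of
-- the set S: its downward closure is S, and it is minimal, i.e. its
-- elements are pairwise incomparable (in particular pairwise distinct).
IsDecomposition : ∀ {q} → (Config q → Set) → List (OmegaConfig q) → Set
IsDecomposition S D =
  (∀ C → S C ⇔ Any (C ⊑_) D) ×
  AllPairs (λ A B → ¬ A ≤Ω B × ¬ B ≤Ω A) D

-- effectively computable decomposition: a (constructive) witness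
Decomposition : ∀ {q} → (Config q → Set) → Set
Decomposition S = Σ (List (OmegaConfig _)) (IsDecomposition S)

module Submission where

-- [[dis(U)]] is the set of configurations above none of the preconditions
-- pre u (u ∈ U); [[dead(U)]] is the set of configurations above none of the
-- elements of a finite basis of the upward-closed set of configurations that
-- can reach one enabling some u ∈ U.  So both have the form Avoids B for a
-- computable list B, and every such set has a computable decomposition: the
-- complement of ↑b is a finite union of ↓-sets of ω-configurations,
-- intersections are taken with meets, and minimisation leaves an antichain.
--
-- The basis is computed by backward saturation from the preconditions of U
-- with minimal predecessors; it terminates by Dickson's lemma in the form
-- "componentwise ≤ on ℕ^q is almost full" (Vytiniotis–Coquand–Wahlstedt).

open import Defs
open import Data.Empty using (⊥-elim)
open import Data.List using (List; []; _∷_; map; foldr; filter; concatMap; cartesianProductWith)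
open import Data.List.Membership.Propositional using (_∈_; find; lose)
open import Data.List.Membership.Propositional.Properties using (∈-map⁺; ∈-filter⁺)
open import Data.List.Relation.Binary.Subset.Propositional using (_⊆_)
open import Data.List.Relation.Unary.All as All using (All; []; _∷_; all?)
import Data.List.Relation.Unary.All.Properties as AllP
open import Data.List.Relation.Unary.AllPairs using (AllPairs; []; _∷_)
import Data.List.Relation.Unary.AllPairs.Properties as AllPairsP
open import Data.List.Relation.Unary.Any as Any using (Any; here; there; any?)
import Data.List.Relation.Unary.Any.Properties as AnyP
open import Data.Nat using (ℕ; zero; suc; _≤_; _≤?_; _+_; _∸_; _⊓_; z≤n)
open import Data.Nat.Properties
  using (≤-trans; ≰⇒>; <⇒≱; ⊓-glb; m⊓n≤m; m⊓n≤n; +-comm; +-monoʳ-≤; m≤m+n; m≤n+m∸n;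
         m≤n+o⇒m∸n≤o; m+n≤o⇒m≤o∸n; m+[n∸m]≡n; module ≤-Reasoning)
open import Data.Product using (_×_; _,_; Σ; ∃; swap)
open import Data.Sum using (_⊎_; inj₁; inj₂; [_,_]′)
import Data.Sum as Sum
open import Data.Vec using ([]; _∷_; zipWith; replicate; head; tail)
open import Data.Vec.Relation.Binary.Pointwise.Inductive as Pointwise using (Pointwise; []; _∷_)
open import Function using (id; _∘_; _on_)
open import Function.Bundles using (_⇔_; mk⇔; Equivalence)
open import Level using (0ℓ)
open import Relation.Binary.Core using (Rel) renaming (_⇒_ to _⊆₂_)
open import Relation.Binary.Construct.Closure.ReflexiveTransitive using (ε; _◅_)
open import Relation.Binary.Construct.Intersection using (_∩_)
open import Relation.Binary.Definitions using (Decidable)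
open import Relation.Binary.PropositionalEquality using (refl; subst)
open import Relation.Nullary using (¬_; Dec; yes; no; ¬?; contradiction)

-- R ↾ x is the relation R once x has been fixed as the first element of a
-- sequence: a later pair (y , z) is good if R y z, or if already R x y.
_↾_ : {X : Set} → Rel X 0ℓ → X → Rel X 0ℓ
(R ↾ x) y z = R y z ⊎ R x y

-- Inductive almost-full relations: every infinite sequence contains x_i, x_j
-- with i < j and R x_i x_j, witnessed by a well-founded tree.  Recursion on
-- this tree is what makes the saturation below terminate.
data AlmostFull {X : Set} : Rel X 0ℓ → Set₁ where
  now   : ∀ {R} → (∀ x y → R x y) → AlmostFull R
  later : ∀ {R} → (∀ x → AlmostFull (R ↾ x)) → AlmostFull R

-- Closure of AF relations under intersection (a constructive Ramsey theorem),
-- proved through a nullary and a unary strengthening.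
module _ {X : Set} where

  _∪ᶜ_ : Rel X 0ℓ → Set → Rel X 0ℓ
  (R ∪ᶜ P) y z = R y z ⊎ P

  _∪ᵘ_ : Rel X 0ℓ → (X → Set) → Rel X 0ℓ
  (R ∪ᵘ U) y z = R y z ⊎ U y

  af-mono : ∀ {R S : Rel X 0ℓ} → R ⊆₂ S → AlmostFull R → AlmostFull S
  af-mono R⊆S (now full) = now λ x y → R⊆S (full x y)
  af-mono R⊆S (later af) = later λ x → af-mono (Sum.map R⊆S R⊆S) (af x)

  ↾-∪ᶜ : ∀ {R : Rel X 0ℓ} {P a} → (R ↾ a) ∪ᶜ P ⊆₂ (R ∪ᶜ P) ↾ a
  ↾-∪ᶜ (inj₁ (inj₁ r)) = inj₁ (inj₁ r)
  ↾-∪ᶜ (inj₁ (inj₂ r)) = inj₂ (inj₁ r)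
  ↾-∪ᶜ (inj₂ p)        = inj₁ (inj₂ p)

  ↾-embeds-∪ᶜ : ∀ {R S : Rel X 0ℓ} {P a} → S ⊆₂ R ∪ᶜ P → S ↾ a ⊆₂ (R ↾ a) ∪ᶜ P
  ↾-embeds-∪ᶜ S⊆ (inj₁ s) = Sum.map₁ inj₁ (S⊆ s)
  ↾-embeds-∪ᶜ S⊆ (inj₂ s) = Sum.map₁ inj₂ (S⊆ s)

  ∪ᶜ-widen : ∀ {R : Rel X 0ℓ} {P a} → R ∪ᶜ P ⊆₂ (R ↾ a) ∪ᶜ P
  ∪ᶜ-widen = Sum.map₁ inj₁

  af-∪ᶜ-×-full : ∀ {R P Q} {T : Rel X 0ℓ} → (∀ y z → (R ∪ᶜ P) y z) →
                 AlmostFull T → T ⊆₂ R ∪ᶜ Q → AlmostFull (R ∪ᶜ (P × Q))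
  af-∪ᶜ-×-full full (now t) T⊆ = now λ y z → pair (full y z) (T⊆ (t y z))
    where
    pair : ∀ {A P Q : Set} → A ⊎ P → A ⊎ Q → A ⊎ (P × Q)
    pair (inj₁ a) _        = inj₁ a
    pair (inj₂ _) (inj₁ a) = inj₁ a
    pair (inj₂ p) (inj₂ q) = inj₂ (p , q)
  af-∪ᶜ-×-full {R} {T = T} full (later t) T⊆ = later λ x →
    af-mono (↾-∪ᶜ {R = R})
      (af-∪ᶜ-×-full {R = R ↾ x} (λ y z → ∪ᶜ-widen {R = R} (full y z)) (t x) (↾-embeds-∪ᶜ {S = T} T⊆))

  af-∪ᶜ-×′ : ∀ {R P Q} {S : Rel X 0ℓ} → AlmostFull S → S ⊆₂ R ∪ᶜ P →
             AlmostFull (R ∪ᶜ Q) → AlmostFull (R ∪ᶜ (P × Q))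
  af-∪ᶜ-×′ (now s) S⊆ afQ = af-∪ᶜ-×-full (λ y z → S⊆ (s y z)) afQ id
  af-∪ᶜ-×′ {R} {S = S} (later s) S⊆ afQ = later λ x →
    af-mono (↾-∪ᶜ {R = R})
      (af-∪ᶜ-×′ {R = R ↾ x} (s x) (↾-embeds-∪ᶜ {S = S} S⊆) (af-mono (∪ᶜ-widen {R = R}) afQ))

  af-∪ᶜ-× : ∀ {R P Q} → AlmostFull (R ∪ᶜ P) → AlmostFull (R ∪ᶜ Q) → AlmostFull (R ∪ᶜ (P × Q))
  af-∪ᶜ-× afP = af-∪ᶜ-×′ afP id

  -- Fixing a first element x reduces it to the nullary case
  -- for the propositions U x and V x, whose premises af-∪ᵘ-∩-fix obtains by
  -- recursion on the trees of S and T.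
  af-∪ᵘ-∩′ : ∀ {R U V} {S T : Rel X 0ℓ} → AlmostFull S → AlmostFull T →
             S ⊆₂ R ∪ᵘ U → T ⊆₂ R ∪ᵘ V → AlmostFull (R ∪ᵘ (λ y → U y × V y))
  af-∪ᵘ-∩-fix : ∀ {R U V} {S T : Rel X 0ℓ} → AlmostFull S → AlmostFull T →
                S ⊆₂ R ∪ᵘ U → T ⊆₂ R ∪ᵘ V →
                ∀ x → AlmostFull (((R ↾ x) ∪ᵘ (λ y → U y × V y)) ∪ᶜ U x)

  af-∪ᵘ-∩′ {R} {U} {V} s t S⊆ T⊆ = later λ x →
    af-mono (λ { (inj₁ (inj₁ (inj₁ r))) → inj₁ (inj₁ r)
               ; (inj₁ (inj₁ (inj₂ r))) → inj₂ (inj₁ r)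
               ; (inj₁ (inj₂ uv))       → inj₁ (inj₂ uv)
               ; (inj₂ uv)              → inj₂ (inj₂ uv) })
      (af-∪ᶜ-× {R = (R ↾ x) ∪ᵘ (λ y → U y × V y)}
        (af-∪ᵘ-∩-fix s t S⊆ T⊆ x)
        (af-mono (Sum.map₁ (Sum.map₂ swap)) (af-∪ᵘ-∩-fix t s T⊆ S⊆ x)))

  af-∪ᵘ-∩-fix (now s) t S⊆ T⊆ x = now λ y z → Sum.map₁ (inj₁ ∘ inj₂) (S⊆ (s x y))
  af-∪ᵘ-∩-fix {R} {U} {V} (later s) t S⊆ T⊆ x =
    af-mono (λ { (inj₁ (inj₁ r)) → inj₁ (inj₁ r)
               ; (inj₁ (inj₂ u)) → inj₂ u
               ; (inj₂ uv)       → inj₁ (inj₂ uv) })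
      (af-∪ᵘ-∩′ {R = (R ↾ x) ∪ᶜ U x} {U} {V} (s x) t
        (λ { (inj₁ s) → Sum.map₁ (inj₁ ∘ inj₁) (S⊆ s) ; (inj₂ s) → inj₁ (Sum.map₁ inj₂ (S⊆ s)) })
        (Sum.map₁ (inj₁ ∘ inj₁) ∘ T⊆))

  af-∪ᵘ-∩ : ∀ {R U V} → AlmostFull (R ∪ᵘ U) → AlmostFull (R ∪ᵘ V) →
            AlmostFull (R ∪ᵘ (λ y → U y × V y))
  af-∪ᵘ-∩ afU afV = af-∪ᵘ-∩′ afU afV id id

  -- Binary case: the intersection of two AF relations is AF.  After fixing x,
  -- (A ∩ B) ↾ x is (A ∩ B) ∪ᵘ (A x ∩ B x), an instance of the unary case.
  af-∩′ : ∀ {A B S T : Rel X 0ℓ} → AlmostFull S → AlmostFull T →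
          S ⊆₂ A → T ⊆₂ B → AlmostFull (A ∩ B)
  af-∩-fix : ∀ {A B S T : Rel X 0ℓ} → AlmostFull S → AlmostFull T →
             S ⊆₂ A → T ⊆₂ B → ∀ x → AlmostFull ((A ∩ B) ∪ᵘ A x)

  af-∩′ s t S⊆ T⊆ = later λ x →
    af-∪ᵘ-∩ (af-∩-fix s t S⊆ T⊆ x) (af-mono (Sum.map₁ swap) (af-∩-fix t s T⊆ S⊆ x))

  af-∩-fix (now s) t S⊆ T⊆ x = now λ y z → inj₂ (S⊆ (s x y))
  af-∩-fix {A} {B} (later s) t S⊆ T⊆ x =
    af-mono (λ { (inj₁ a , inj₁ b) → inj₁ (a , b) ; (inj₂ a , _) → inj₂ a ; (_ , inj₂ a) → inj₂ a })
      (af-∩′ {A = A ↾ x} {B = B ∪ᵘ A x} (s x) t (Sum.map S⊆ S⊆) (inj₁ ∘ T⊆))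

  af-∩ : ∀ {A B : Rel X 0ℓ} → AlmostFull A → AlmostFull B → AlmostFull (A ∩ B)
  af-∩ afA afB = af-∩′ afA afB id id

af-on : ∀ {X Y : Set} {R : Rel X 0ℓ} (f : Y → X) → AlmostFull R → AlmostFull (R on f)
af-on f (now full) = now λ x y → full (f x) (f y)
af-on f (later af) = later λ y → af-on f (af (f y))

af-Pointwise : ∀ {X : Set} {R : Rel X 0ℓ} → AlmostFull R → ∀ n → AlmostFull (Pointwise R {n} {n})
af-Pointwise af zero    = now λ { [] [] → [] }
af-Pointwise af (suc n) =
  af-mono (λ { {_ ∷ _} {_ ∷ _} (r , rs) → r ∷ rs })
          (af-∩ (af-on head af) (af-on tail (af-Pointwise af n)))

af-≤-above : ∀ k {R : Rel ℕ 0ℓ} → (∀ {m n} → m ≤ n ⊎ k ≤ m → R m n) → AlmostFull R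
af-≤-above zero    R⊇ = now λ m n → R⊇ (inj₂ z≤n)
af-≤-above (suc k) R⊇ = later λ j → fixed j (j ≤? k)
  where
  fixed : ∀ j → Dec (j ≤ k) → AlmostFull (_ ↾ j)
  fixed j (yes j≤k) = af-≤-above k λ
    { (inj₁ m≤n) → inj₁ (R⊇ (inj₁ m≤n))
    ; (inj₂ k≤m) → inj₂ (R⊇ (inj₁ (≤-trans j≤k k≤m))) }
  fixed j (no j≰k)  = now λ m n → inj₂ (R⊇ (inj₂ (≰⇒> j≰k)))

af-≤ : AlmostFull _≤_
af-≤ = later λ k → af-≤-above k id

-- Saturating a finite set under a finitely branching successor map, up to
-- ≼-covering, terminates when ≼ is almost full: every element added is not
-- above an earlier one, and the AF tree bounds such bad sequences.
module Saturate {X : Set} (_≼_ : Rel X 0ℓ) (_≼?_ : Decidable _≼_)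
                (Good : X → Set) (next : X → List X)
                (next-good : ∀ {x} → Good x → All Good (next x)) where

  Covered : List X → X → Set
  Covered B x = Any (_≼ x) B

  successors : List X → List X
  successors = concatMap next

  ∈-successors : ∀ {B b x} → b ∈ B → x ∈ next b → x ∈ successors B
  ∈-successors b∈B x∈next = AnyP.concatMap⁺ next (lose b∈B x∈next)

  Closed : List X → Set
  Closed B = All (Covered B) (successors B)

  record Saturation (B₀ : List X) : Set where
    field
      basis   : List X
      initial : B₀ ⊆ basis
      good    : All Good basis
      closed  : Closed basis

  uncovered : ∀ B → All Good B → Closed B ⊎ Σ X λ x → Good x × ¬ Covered B x
  uncovered B good with all? (λ x → any? (_≼? x) B) (successors B)
  ... | yes closed = inj₁ closed
  ... | no ¬closed with find (AllP.¬All⇒Any¬ (λ x → any? (_≼? x) B) (successors B) ¬closed)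
  ...   | x , x∈succ , x∉ =
    inj₂ (x , All.lookup (AllP.concat⁺ (AllP.map⁺ (All.map next-good good))) x∈succ , x∉)

  shrink : ∀ {x B} → Saturation (x ∷ B) → Saturation B
  shrink sat = record { basis = basis ; initial = initial ∘ there ; good = good ; closed = closed }
    where open Saturation sat

  -- The invariant of the saturation loop: an S-related pair y, z is
  -- ≼-related, or y is already covered.
  Progress : List X → Rel X 0ℓ
  Progress B y z = y ≼ z ⊎ Covered B y

  saturate : ∀ {S} → AlmostFull S → ∀ B → All Good B → S ⊆₂ Progress B → Saturation B
  saturate af B good S⊆ with uncovered B good
  ... | inj₁ closed = record { basis = B ; initial = id ; good = good ; closed = closed }
  saturate (later af) B good S⊆ | inj₂ (x , good-x , x∉) =
    shrink (saturate (af x) (x ∷ B) (good-x ∷ good)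
      λ { (inj₁ s) → Sum.map₂ there (S⊆ s)
        ; (inj₂ s) → [ inj₂ ∘ here , ⊥-elim ∘ x∉ ]′ (S⊆ s) })
  saturate (now full) B good S⊆ | inj₂ (x , good-x , x∉) with uncovered (x ∷ B) (good-x ∷ good)
  ... | inj₁ closed = record { basis = x ∷ B ; initial = there ; good = good-x ∷ good ; closed = closed }
  ... | inj₂ (y , _ , y∉) = ⊥-elim ([ y∉ ∘ here , x∉ ]′ (S⊆ (full x y)))

module Minimise {A : Set} (_≼_ : Rel A 0ℓ) (_≼?_ : Decidable _≼_) where

  Incomparable : A → A → Set
  Incomparable a b = ¬ a ≼ b × ¬ b ≼ a

  insert : A → List A → List A
  insert a M with any? (a ≼?_) M
  ... | yes _ = M
  ... | no  _ = a ∷ filter (λ b → ¬? (b ≼? a)) M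

  minimise : List A → List A
  minimise = foldr insert []

  insert-antichain : ∀ a M → AllPairs Incomparable M → AllPairs Incomparable (insert a M)
  insert-antichain a M M-antichain with any? (a ≼?_) M
  ... | yes _   = M-antichain
  ... | no  a⋠M =
    All.zip (AllP.filter⁺ _ (AllP.¬Any⇒All¬ M a⋠M) , AllP.all-filter _ M)
      ∷ AllPairsP.filter⁺ _ M-antichain

  minimise-antichain : ∀ L → AllPairs Incomparable (minimise L)
  minimise-antichain []      = []
  minimise-antichain (a ∷ L) = insert-antichain a (minimise L) (minimise-antichain L)

  module _ {P : A → Set} (P-up : ∀ {a b} → P a → a ≼ b → P b) where

    insert⁺ : ∀ a M → Any P (a ∷ M) → Any P (insert a M)
    insert⁺ a M Pa∷M with any? (a ≼?_) M | Pa∷M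
    ... | yes a≼M | here Pa  = Any.map (P-up Pa) a≼M
    ... | yes _   | there PM = PM
    ... | no  _   | here Pa  = here Pa
    ... | no  _   | there PM with find PM
    ...   | b , b∈M , Pb with b ≼? a
    ...     | yes b≼a = here (P-up Pb b≼a)
    ...     | no  b⋠a = there (lose (∈-filter⁺ (λ b → ¬? (b ≼? a)) b∈M b⋠a) Pb)

    insert⁻ : ∀ a M → Any P (insert a M) → Any P (a ∷ M)
    insert⁻ a M P-ins with any? (a ≼?_) M | P-ins
    ... | yes _ | PM        = there PM
    ... | no  _ | here Pa   = here Pa
    ... | no  _ | there P-f = there (AnyP.filter⁻ _ P-f)

    minimise⁺ : ∀ L → Any P L → Any P (minimise L)
    minimise⁺ (a ∷ L) (here Pa)  = insert⁺ a (minimise L) (here Pa)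
    minimise⁺ (a ∷ L) (there PL) = insert⁺ a (minimise L) (there (minimise⁺ L PL))

    minimise⁻ : ∀ L → Any P (minimise L) → Any P L
    minimise⁻ (a ∷ L) P-min with insert⁻ a (minimise L) P-min
    ... | here Pa  = here Pa
    ... | there PM = there (minimise⁻ L PM)

minω : ℕω → ℕω → ℕω
minω (fin a) (fin b) = fin (a ⊓ b)
minω (fin a) ω       = fin a
minω ω       b       = b

minω-glb : ∀ {m} a b → fin m ≤ω a → fin m ≤ω b → fin m ≤ω minω a b
minω-glb (fin a) (fin b) (fin≤fin m≤a) (fin≤fin m≤b) = fin≤fin (⊓-glb m≤a m≤b)
minω-glb (fin a) ω       m≤a           _             = m≤a
minω-glb ω       b       _             m≤b           = m≤b

minω-lower : ∀ {m} a b → fin m ≤ω minω a b → fin m ≤ω a × fin m ≤ω b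
minω-lower (fin a) (fin b) (fin≤fin m≤a⊓b) =
  fin≤fin (≤-trans m≤a⊓b (m⊓n≤m a b)) , fin≤fin (≤-trans m≤a⊓b (m⊓n≤n a b))
minω-lower (fin a) ω       m≤a = m≤a , (_ ≤ω-top)
minω-lower ω       b       m≤b = (_ ≤ω-top) , m≤b

≤ω-trans : ∀ {a b c} → a ≤ω b → b ≤ω c → a ≤ω c
≤ω-trans (fin≤fin a≤b) (fin≤fin b≤c) = fin≤fin (≤-trans a≤b b≤c)
≤ω-trans _             (_ ≤ω-top)    = _ ≤ω-top

_≤ω?_ : Decidable _≤ω_
a     ≤ω? ω     = yes (a ≤ω-top)
ω     ≤ω? fin b = no λ ()
fin a ≤ω? fin b with a ≤? b
... | yes a≤b = yes (fin≤fin a≤b)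
... | no  a≰b = no λ { (fin≤fin a≤b) → a≰b a≤b }

_≤Ω?_ : ∀ {q} → Decidable (_≤Ω_ {q})
_≤Ω?_ = Pointwise.decidable _≤ω?_

⊑-≤Ω-trans : ∀ {q} {C : Config q} {A B} → C ⊑ A → A ≤Ω B → C ⊑ B
⊑-≤Ω-trans = Pointwise.trans ≤ω-trans

meet : ∀ {q} → OmegaConfig q → OmegaConfig q → OmegaConfig q
meet = zipWith minω

⊑-meet : ∀ {q} {C : Config q} A B → C ⊑ A → C ⊑ B → C ⊑ meet A B
⊑-meet []      []      []           []           = []
⊑-meet (a ∷ A) (b ∷ B) (c≤a ∷ C⊑A) (c≤b ∷ C⊑B) = minω-glb a b c≤a c≤b ∷ ⊑-meet A B C⊑A C⊑B

⊑-meet⁻ : ∀ {q} {C : Config q} A B → C ⊑ meet A B → C ⊑ A × C ⊑ B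
⊑-meet⁻ []      []      []            = [] , []
⊑-meet⁻ (a ∷ A) (b ∷ B) (c≤ab ∷ C⊑AB) with minω-lower a b c≤ab | ⊑-meet⁻ A B C⊑AB
... | c≤a , c≤b | C⊑A , C⊑B = c≤a ∷ C⊑A , c≤b ∷ C⊑B

⊑-top : ∀ {q} (C : Config q) → C ⊑ replicate q ω
⊑-top []      = []
⊑-top (c ∷ C) = (_ ≤ω-top) ∷ ⊑-top C

-- The complement of the upward closure of b is the union of the sets
-- {C : C_i < b_i}, one for each coordinate i with b_i > 0.
notAbove : ∀ {q} → Config q → List (OmegaConfig q)
notAbove []                  = []
notAbove (zero ∷ b)          = map (ω ∷_) (notAbove b)
notAbove {suc q} (suc k ∷ b) = (fin k ∷ replicate q ω) ∷ map (ω ∷_) (notAbove b)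

module _ {q} {c : ℕ} {C : Config q} {L : List (OmegaConfig q)} where

  ω∷-⊑ : Any (C ⊑_) L → Any ((c ∷ C) ⊑_) (map (ω ∷_) L)
  ω∷-⊑ = AnyP.map⁺ ∘ Any.map ((_ ≤ω-top) ∷_)

  ω∷-⊑⁻ : Any ((c ∷ C) ⊑_) (map (ω ∷_) L) → Any (C ⊑_) L
  ω∷-⊑⁻ = Any.map (λ { (_ ∷ C⊑A) → C⊑A }) ∘ AnyP.map⁻

notAbove-sound : ∀ {q} (b C : Config q) → Any (C ⊑_) (notAbove b) → ¬ b ≤ᶜ C
notAbove-sound (zero  ∷ b) (c ∷ C) C∈                         (_ ∷ b≤C) = notAbove-sound b C (ω∷-⊑⁻ C∈) b≤C
notAbove-sound (suc k ∷ b) (c ∷ C) (here (fin≤fin c≤k ∷ _)) (k<c ∷ _) = <⇒≱ k<c c≤k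
notAbove-sound (suc k ∷ b) (c ∷ C) (there C∈)                 (_ ∷ b≤C) = notAbove-sound b C (ω∷-⊑⁻ C∈) b≤C

notAbove-complete : ∀ {q} (b C : Config q) → ¬ b ≤ᶜ C → Any (C ⊑_) (notAbove b)
notAbove-complete []          []      b≰C = contradiction [] b≰C
notAbove-complete (zero  ∷ b) (c ∷ C) b≰C = ω∷-⊑ (notAbove-complete b C (b≰C ∘ (z≤n ∷_)))
notAbove-complete (suc k ∷ b) (c ∷ C) b≰C with c ≤? k
... | yes c≤k = here (fin≤fin c≤k ∷ ⊑-top C)
... | no  c≰k = there (ω∷-⊑ (notAbove-complete b C (b≰C ∘ (≰⇒> c≰k ∷_))))

Avoids : ∀ {q} → List (Config q) → Config q → Set
Avoids B C = All (λ b → ¬ b ≤ᶜ C) B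

-- An ω-configuration list with downward closure Avoids B: the meets of one
-- choice from notAbove b for each b in B.
avoiding : ∀ {q} → List (Config q) → List (OmegaConfig q)
avoiding {q} []      = replicate q ω ∷ []
avoiding     (b ∷ B) = cartesianProductWith meet (avoiding B) (notAbove b)

avoiding-sound : ∀ {q} (B : List (Config q)) C → Any (C ⊑_) (avoiding B) → Avoids B C
avoiding-sound []      C _  = []
avoiding-sound (b ∷ B) C C∈
  with AnyP.cartesianProductWith⁻ meet (λ {A} {A′} → ⊑-meet⁻ A A′) (avoiding B) (notAbove b) C∈
... | C∈avoiding , C∈notAbove = notAbove-sound b C C∈notAbove ∷ avoiding-sound B C C∈avoiding

avoiding-complete : ∀ {q} (B : List (Config q)) C → Avoids B C → Any (C ⊑_) (avoiding B)
avoiding-complete []      C []          = here (⊑-top C)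
avoiding-complete (b ∷ B) C (b≰C ∷ B≰C) =
  AnyP.cartesianProductWith⁺ meet (λ {A} {A′} → ⊑-meet A A′)
    (avoiding-complete B C B≰C) (notAbove-complete b C b≰C)

decomposition : ∀ {q} {S : Config q → Set} (L : List (OmegaConfig q)) →
                (∀ C → S C ⇔ Any (C ⊑_) L) → Decomposition S
decomposition L S⇔L =
  minimise L ,
  (λ C → mk⇔ (minimise⁺ ⊑-≤Ω-trans L ∘ to (S⇔L C)) (from (S⇔L C) ∘ minimise⁻ ⊑-≤Ω-trans L)) ,
  minimise-antichain L
  where
  open Minimise _≤Ω_ _≤Ω?_
  open Equivalence

avoids-decomposition : ∀ {q} {S : Config q → Set} (B : List (Config q)) →
                       (∀ C → S C ⇔ Avoids B C) → Decomposition S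
avoids-decomposition B S⇔B = decomposition (avoiding B) λ C →
  mk⇔ (avoiding-complete B C ∘ to (S⇔B C)) (from (S⇔B C) ∘ avoiding-sound B C)
  where open Equivalence

_≤ᶜ?_ : ∀ {q} → Decidable (_≤ᶜ_ {q})
_≤ᶜ?_ = Pointwise.decidable _≤?_

≤ᶜ-trans : ∀ {q} {A B C : Config q} → A ≤ᶜ B → B ≤ᶜ C → A ≤ᶜ C
≤ᶜ-trans = Pointwise.trans ≤-trans

predBasis-≤⁺ : ∀ x y c m → x ≤ c → m ≤ (c ∸ x) + y → x + (m ∸ y) ≤ c
predBasis-≤⁺ x y c m x≤c m≤c-x+y = begin
  x + (m ∸ y)  ≤⟨ +-monoʳ-≤ x (m≤n+o⇒m∸n≤o m y (subst (m ≤_) (+-comm (c ∸ x) y) m≤c-x+y)) ⟩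
  x + (c ∸ x)  ≡⟨ m+[n∸m]≡n x≤c ⟩
  c            ∎
  where open ≤-Reasoning

predBasis-≤⁻ : ∀ x y c m → x + (m ∸ y) ≤ c → x ≤ c × m ≤ (c ∸ x) + y
predBasis-≤⁻ x y c m ≤c = ≤-trans (m≤m+n x (m ∸ y)) ≤c , (begin
  m            ≤⟨ m≤n+m∸n m y ⟩
  y + (m ∸ y)  ≤⟨ +-monoʳ-≤ y (m+n≤o⇒m≤o∸n (m ∸ y) (subst (_≤ c) (+-comm x (m ∸ y)) ≤c)) ⟩
  y + (c ∸ x)  ≡⟨ +-comm y (c ∸ x) ⟩
  (c ∸ x) + y  ∎)
  where open ≤-Reasoning

-- predBasis t m = pre t + (m ∸ post t) is the least configuration at which
-- t is enabled and firing t leads to a configuration above m.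
predBasis : ∀ {q} → Trans q → Config q → Config q
predBasis t m = zipWith _+_ (pre t) (zipWith _∸_ m (post t))

predBasis-minimal : ∀ {q} (t : Trans q) {C m} → enabled t C → m ≤ᶜ fire t C → predBasis t m ≤ᶜ C
predBasis-minimal ([] ⇒ [])             {[]}    {[]}    []           []         = []
predBasis-minimal ((x ∷ xs) ⇒ (y ∷ ys)) {c ∷ C} {m ∷ M} (x≤c ∷ xs≤C) (m≤ ∷ M≤) =
  predBasis-≤⁺ x y c m x≤c m≤ ∷ predBasis-minimal (xs ⇒ ys) xs≤C M≤

predBasis-sound : ∀ {q} (t : Trans q) {C m} → predBasis t m ≤ᶜ C → enabled t C × m ≤ᶜ fire t C
predBasis-sound ([] ⇒ [])             {[]}    {[]}    []        = [] , []
predBasis-sound ((x ∷ xs) ⇒ (y ∷ ys)) {c ∷ C} {m ∷ M} (≤c ∷ ≤C)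
  with predBasis-≤⁻ x y c m ≤c | predBasis-sound (xs ⇒ ys) ≤C
... | x≤c , m≤ | xs≤C , M≤ = x≤c ∷ xs≤C , m≤ ∷ M≤

-- Backward coverability: the configurations from which some transition of U
-- can become enabled form the upward closure of a computable finite basis,
-- so [[dead(U)]] is Avoids of that basis.
module BackwardCoverability (P : ReplicatedSystem) (U : List (Trans (q P))) where

  CanEnable : Config (q P) → Set
  CanEnable C = ∃ λ C′ → Reach P C C′ × Any (λ t → enabled t C′) U

  Sound : Config (q P) → Set
  Sound b = ∀ {C} → b ≤ᶜ C → CanEnable C

  predecessors : Config (q P) → List (Config (q P))
  predecessors m = map (λ t → predBasis t m) (T P)

  predecessors-sound : ∀ {m} → Sound m → All Sound (predecessors m)
  predecessors-sound m-sound = AllP.map⁺ (All.tabulate λ {t} t∈T pb≤C →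
    let en , m≤ = predBasis-sound t pb≤C
        C′ , C→C′ , enables = m-sound m≤
    in C′ , (t , t∈T , en , refl) ◅ C→C′ , enables)

  pre-sound : All Sound (map pre U)
  pre-sound = AllP.map⁺ (All.tabulate λ u∈U pre≤C → _ , ε , lose u∈U pre≤C)

  open Saturate _≤ᶜ_ _≤ᶜ?_ Sound predecessors predecessors-sound

  -- Termination of the saturation is Dickson's lemma for ℕ^q.
  saturation : Saturation (map pre U)
  saturation = saturate (af-Pointwise af-≤ (q P)) (map pre U) pre-sound inj₁

  open Saturation saturation public using (basis)
  open Saturation saturation using (initial; good; closed)

  covered-≤ : ∀ {C D} → Covered basis C → C ≤ᶜ D → Covered basis D
  covered-≤ C-cov C≤D = Any.map (λ b≤C → ≤ᶜ-trans b≤C C≤D) C-cov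

  -- Completeness of the basis, by induction on the path to the enabling
  -- configuration, using that basis is closed under minimal predecessors.
  reach-covered : ∀ {C C′} → Reach P C C′ → Any (λ t → enabled t C′) U → Covered basis C
  reach-covered ε enables with find enables
  ... | u , u∈U , pre≤C = lose (initial (∈-map⁺ pre u∈U)) pre≤C
  reach-covered ((t , t∈T , en , refl) ◅ C→C′) enables with find (reach-covered C→C′ enables)
  ... | b , b∈basis , b≤fire =
    covered-≤ (All.lookup closed (∈-successors b∈basis (∈-map⁺ (λ t → predBasis t b) t∈T)))
              (predBasis-minimal t en b≤fire)

  canEnable⇔covered : ∀ C → CanEnable C ⇔ Covered basis C
  canEnable⇔covered C = mk⇔ (λ { (C′ , C→C′ , enables) → reach-covered C→C′ enables })
    λ C-cov → let b , b∈basis , b≤C = find C-cov in All.lookup good b∈basis b≤C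

  dead⇔¬canEnable : ∀ C → Dead P U C ⇔ (¬ CanEnable C)
  dead⇔¬canEnable C = mk⇔
    (λ dead (C′ , C→C′ , enables) → let t , t∈U , en = find enables in All.lookup dead t∈U C′ C→C′ en)
    (λ ¬canEnable → All.tabulate λ t∈U C′ C→C′ en → ¬canEnable (C′ , C→C′ , lose t∈U en))

  dead⇔avoids : ∀ C → Dead P U C ⇔ Avoids basis C
  dead⇔avoids C = mk⇔
    (λ dead → AllP.¬Any⇒All¬ basis (to (dead⇔¬canEnable C) dead ∘ from (canEnable⇔covered C)))
    (λ avoids → from (dead⇔¬canEnable C) (AllP.All¬⇒¬Any avoids ∘ to (canEnable⇔covered C)))
    where open Equivalence

dis⇔avoids : (P : ReplicatedSystem) (U : List (Trans (q P))) → ∀ C → Dis P U C ⇔ Avoids (map pre U) C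
dis⇔avoids P U C = mk⇔ AllP.map⁺ AllP.map⁻

proposition5 : (P : ReplicatedSystem) (U : List (Trans (q P))) → U ⊆ T P →
    Decomposition (Dis P U) × Decomposition (Dead P U)
proposition5 P U _ =
  avoids-decomposition (map pre U) (dis⇔avoids P U) ,
  avoids-decomposition basis dead⇔avoids
  where open BackwardCoverability P U
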